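{- Let $D$ be an additive right invariant distance on $S_\infty$ taking values in $\mathbb{N}\cup\{0\}$. For positive integers $k,m,q$ let $\beta_D(k,m,q)$ be the number of split types $\sigma$ with $m(\sigma)=m$, $q(\sigma)=q$ and $D(\sigma)=k$. Then $$\beta_D(k,m,q)=\sum_{(k_1,\dots,k_q)}\ \sum_{(m_1,\dots,m_q)}\ \prod_{i=1}^q\beta_D(k_i,m_i,1),$$ where the sums run over all $q$-compositions $(k_1,\dots,k_q)$ of $k$ and all $q$-compositions $(m_1,\dots,m_q)$ of $m$.
   Context: $S_n$ is the group of permutations of $\{1,\dots,n\}$ in one-line notation; $S_\infty$ is the group of permutations of $\{1,2,\dots\}$ fixing all but finitely many entries, with $S_n\subset S_\infty$ as the permutations fixing all entries $>n$. For $\pi\in S_a$, $\tau\in S_b$, the concatenation is $\pi+\tau=(\pi(1)\ldots\pi(a)\,(a+\tau(1))\ldots(a+\tau(b)))\in S_{a+b}$. A permutation is connected if it is not of the form $\pi+\tau$ with $\pi\in S_a,\tau\in S_b$, $a,b\ge1$; each permutation of $S_n$ is uniquely a concatenation of connected permutations (split decomposition). A split type is a permutation $\sigma\in S_m$ all of whose split-decomposition parts are nontrivial (not $(1)\in S_1$); $m(\sigma)$ is the unique $m$ with $\sigma\in S_m$ a split type, $q(\sigma)$ the number of its split-decomposition parts. A metric $D$ on $S_\infty$ is right invariant if $D(uw,vw)=D(u,v)$ for all $u,v,w$; write $D(u)=D(\mathrm{id},u)$. $D$ is additive if $D(u+v)=D(u)+D(v)$ for all $u\in S_a$, $v\in S_b$.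 A $q$-composition of a positive integer $k$ is an ordered $q$-tuple of positive integers summing to $k$. -}

module Defs where

open import Data.Nat using (ℕ; zero; suc; _+_; _*_; _∸_; _≤_; _<_; _⊔_; _<?_; _≤?_)
open import Data.Nat.Properties
open import Data.Fin using (Fin)
open import Data.List using (List; []; _∷_; map; concatMap; upTo; zipWith)
open import Data.Nat.ListAction using (sum; product)
open import Data.Product using (Σ; _×_; _,_)
open import Data.Empty using (⊥-elim)
open import Relation.Nullary using (¬_; yes; no)
open import Relation.Binary.PropositionalEquality

-- S_∞ : permutations of ℕ (positions 0,1,2,... stand for 1,2,3,...)
-- fixing all but finitely many entries.

record SInf : Set where
  field
    fun     : ℕ → ℕ
    inv     : ℕ → ℕ
    inv-fun : ∀ i → inv (fun i) ≡ i
    fun-inv : ∀ i → fun (inv i) ≡ i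
    bound   : ℕ
    fixes   : ∀ i → bound ≤ i → fun i ≡ i

open SInf public

_≈_ : SInf → SInf → Set
u ≈ v = ∀ i → fun u i ≡ fun v i

infix 4 _≈_ _∈S_

idP : SInf
idP = record { fun = λ i → i ; inv = λ i → i ; inv-fun = λ _ → refl
             ; fun-inv = λ _ → refl ; bound = 0 ; fixes = λ _ _ → refl }

_·_ : SInf → SInf → SInf
u · w = record
  { fun = λ i → fun u (fun w i)
  ; inv = λ i → inv w (inv u i)
  ; inv-fun = λ i → trans (cong (inv w) (inv-fun u (fun w i))) (inv-fun w i)
  ; fun-inv = λ i → trans (cong (fun u) (fun-inv w (inv u i))) (fun-inv u i)
  ; bound = bound u ⊔ bound w
  ; fixes = λ i p → trans (cong (fun u) (fixes w i (m⊔n≤o⇒n≤o (bound u) (bound w) p)))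
                          (fixes u i (m⊔n≤o⇒m≤o (bound u) (bound w) p))
  }

-- u ∈ S_a : u fixes every entry ≥ a (0-based)
_∈S_ : SInf → ℕ → Set
u ∈S a = ∀ i → a ≤ i → fun u i ≡ i

private
  lt-pres : (a : ℕ) (f g : ℕ → ℕ) → (∀ i → g (f i) ≡ i) → (∀ i → a ≤ i → f i ≡ i)
          → ∀ i → i < a → f i < a
  lt-pres a f g gf fx i i<a with a ≤? f i
  ... | no ¬p = ≰⇒> ¬p
  ... | yes p = ⊥-elim (<⇒≱ i<a (subst (a ≤_) fi≡i p))
    where
    fi≡i : f i ≡ i
    fi≡i = trans (sym (gf (f i))) (trans (cong g (fx (f i) p)) (gf i))

  inv-fixes : (a : ℕ) (u : SInf) → u ∈S a → ∀ i → a ≤ i → inv u i ≡ i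
  inv-fixes a u ua i p = trans (cong (inv u) (sym (ua i p))) (inv-fun u i)

cfun : ℕ → (ℕ → ℕ) → (ℕ → ℕ) → ℕ → ℕ
cfun a f h i with i <? a
... | yes _ = f i
... | no  _ = a + h (i ∸ a)

private
  cfun-inv : (a : ℕ) (f g F G : ℕ → ℕ) → (∀ i → g (f i) ≡ i) → (∀ i → i < a → f i < a)
           → (∀ i → G (F i) ≡ i) → ∀ i → cfun a g G (cfun a f F i) ≡ i
  cfun-inv a f g F G gf flt GF i with i <? a
  ... | yes p with f i <? a
  ...   | yes _ = gf i
  ...   | no q  = ⊥-elim (q (flt i p))
  cfun-inv a f g F G gf flt GF i | no p with a + F (i ∸ a) <? a
  ...   | yes q = ⊥-elim (m+n≮m a (F (i ∸ a)) q)
  ...   | no _ rewrite m+n∸m≡n a (F (i ∸ a)) | GF (i ∸ a) = m+[n∸m]≡n (≮⇒≥ p)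

  cfun-fix : (a b : ℕ) (f F : ℕ → ℕ) → (∀ i → b ≤ i → F i ≡ i)
           → ∀ i → a + b ≤ i → cfun a f F i ≡ i
  cfun-fix a b f F Fx i p with i <? a
  ... | yes q = ⊥-elim (<⇒≱ q (≤-trans (m≤m+n a b) p))
  ... | no q rewrite Fx (i ∸ a) (subst (_≤ i ∸ a) (m+n∸m≡n a b) (∸-monoˡ-≤ a p))
        = m+[n∸m]≡n (≮⇒≥ q)

-- concatenation u + v for u ∈ S_a :
-- (u + v)(i) = u(i) for i < a,  a + v(i - a) for i ≥ a
concat : (a : ℕ) (u : SInf) → u ∈S a → SInf → SInf
concat a u ua v = record
  { fun = cfun a (fun u) (fun v)
  ; inv = cfun a (inv u) (inv v)
  ; inv-fun = cfun-inv a (fun u) (inv u) (fun v) (inv v) (inv-fun u)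
                (lt-pres a (fun u) (inv u) (inv-fun u) ua) (inv-fun v)
  ; fun-inv = cfun-inv a (inv u) (fun u) (inv v) (fun v) (fun-inv u)
                (lt-pres a (inv u) (fun u) (fun-inv u) (inv-fixes a u ua)) (fun-inv v)
  ; bound = a + bound v
  ; fixes = cfun-fix a (bound v) (fun u) (fun v) (fixes v)
  }

record IsMetric (D : SInf → SInf → ℕ) : Set where
  field
    zero⇒≈   : ∀ u v → D u v ≡ 0 → u ≈ v
    ≈⇒zero   : ∀ u v → u ≈ v → D u v ≡ 0
    symmetric : ∀ u v → D u v ≡ D v u
    triangle  : ∀ u v w → D u w ≤ D u v + D v w

RightInvariant : (SInf → SInf → ℕ) → Set
RightInvariant D = ∀ u v w → D (u · w) (v · w) ≡ D u v

-- D(u + v) = D(u) + D(v) for u ∈ S_a, v ∈ S_b, where D(u) = D(id, u)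
Additive : (SInf → SInf → ℕ) → Set
Additive D = ∀ (a b : ℕ) (u v : SInf) (ua : u ∈S a) → v ∈S b
           → D idP (concat a u ua v) ≡ D idP u + D idP v

Connected : ℕ → SInf → Set
Connected a τ = τ ∈S a × 1 ≤ a ×
  ¬ (Σ ℕ λ b → Σ ℕ λ c → Σ SInf λ π → Σ SInf λ ρ → Σ (π ∈S b) λ πb →
       ρ ∈S c × 1 ≤ b × 1 ≤ c × b + c ≡ a × τ ≈ concat b π πb ρ)

Trivial : ℕ → SInf → Set
Trivial a τ = a ≡ 1 × τ ≈ idP

-- IsSplitType m q σ : σ ∈ S_m has split decomposition σ = τ₁ + … + τ_q
-- into q connected, nontrivial parts; i.e. σ is a split type with
-- m(σ) = m and q(σ) = q.
data IsSplitType : ℕ → ℕ → SInf → Set where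
  nil  : ∀ {σ} → σ ≈ idP → IsSplitType 0 0 σ
  cons : ∀ {a m q σ} (τ : SInf) (τa : τ ∈S a) (ρ : SInf)
       → Connected a τ → ¬ Trivial a τ → IsSplitType m q ρ
       → σ ≈ concat a τ τa ρ → IsSplitType (a + m) (suc q) σ

IsCount : (SInf → Set) → ℕ → Set
IsCount P N = Σ (Fin N → SInf) λ e →
  (∀ i → P (e i)) × (∀ i j → e i ≈ e j → i ≡ j) × (∀ s → P s → Σ (Fin N) λ i → e i ≈ s)

IsBeta : (SInf → SInf → ℕ) → ℕ → ℕ → ℕ → ℕ → Set
IsBeta D k m q N = IsCount (λ σ → IsSplitType m q σ × D idP σ ≡ k) N

compositions : ℕ → ℕ → List (List ℕ)
compositions zero zero    = [] ∷ []
compositions zero (suc k) = []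
compositions (suc q) k =
  concatMap (λ j → map (suc j ∷_) (compositions q (k ∸ suc j))) (upTo k)

compSum : ℕ → ℕ → ℕ → (ℕ → ℕ → ℕ) → ℕ
compSum q k m f =
  sum (map (λ ks → sum (map (λ ms → product (zipWith f ks ms)) (compositions q m)))
           (compositions q k))

module Submission where

-- Every split type σ with q+1 parts factors uniquely as σ = τ + ρ, where the
-- first part τ ∈ S_{l+1} is connected and nontrivial (a split type with one
-- part) and ρ is a split type with q parts; additivity gives D(σ) = D(τ) + D(ρ),
-- and D(τ) ≥ 1 because a nontrivial connected τ is not the identity.  Hence
-- the split types counted by β_D(k,m,q+1) are in bijection (up to equality of
-- permutations) with the disjoint union over j < k, l < m of the pairs (τ, ρ)
-- counted by β_D(j+1,l+1,1) · β_D(k-j-1,m-l-1,q).  Induction on q, starting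
-- from the identity as the only split type with no parts, then shows that the
-- number of split types is the composition sum, and the theorem follows
-- because a count (IsCount) is unique.

open import Defs
open import Data.Nat using (ℕ; zero; suc; _+_; _*_; _∸_; _≤_; _<_; z≤n; s≤s; _<?_; _≤?_)
open import Data.Nat.Properties
open import Data.Fin using (Fin; zero)
open import Data.Fin.Properties using (+↔⊎; *↔×; injective⇒≤)
open import Data.List using (List; []; _∷_; _++_; map; concatMap; applyUpTo; upTo; zipWith)
open import Data.List.Properties using (map-++; map-∘; map-cong; map-applyUpTo)
open import Data.Nat.ListAction using (sum; product)
open import Data.Nat.ListAction.Properties using (sum-++)
open import Data.Product using (Σ; _×_; _,_; proj₁; proj₂)
open import Data.Sum using (_⊎_; inj₁; inj₂; [_,_]′)
open import Data.Empty using (⊥; ⊥-elim)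
open import Function using (_∘_)
open import Function.Bundles using (_↔_; Inverse)
open import Relation.Nullary using (¬_; yes; no)
open import Relation.Binary.Definitions using (tri<; tri≈; tri>)
open import Relation.Binary.PropositionalEquality
open import Algebra.Properties.CommutativeSemigroup +-commutativeSemigroup using (interchange)
open ≡-Reasoning

-- Counting up to ≈

Enumerates : {A : Set} → (SInf → Set) → (A → SInf) → Set
Enumerates {A} P e =
  (∀ a → P (e a)) × (∀ a b → e a ≈ e b → a ≡ b) × (∀ s → P s → Σ A λ a → e a ≈ s)

count-via : ∀ {A : Set} {P N} → Fin N ↔ A → (e : A → SInf) → Enumerates P e → IsCount P N
count-via {A} {P} {N} ι e (e-in , e-inj , e-onto) = e ∘ to , e-in ∘ to , injective , onto
  where
  open Inverse ι
  injective : ∀ i j → e (to i) ≈ e (to j) → i ≡ j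
  injective i j eq = begin
    i              ≡⟨ sym (strictlyInverseʳ i) ⟩
    from (to i)    ≡⟨ cong from (e-inj (to i) (to j) eq) ⟩
    from (to j)    ≡⟨ strictlyInverseʳ j ⟩
    j              ∎
  onto : ∀ s → P s → Σ (Fin N) λ i → e (to i) ≈ s
  onto s p with e-onto s p
  ... | a , ea≈s = from a , subst (λ x → e x ≈ s) (sym (strictlyInverseˡ a)) ea≈s

-- Locating the elements of one enumeration in another is injective.
count-≤ : ∀ {P N N'} → IsCount P N → IsCount P N' → N ≤ N'
count-≤ {N = N} {N'} (e , e-in , e-inj , _) (e' , _ , _ , e'-onto) = injective⇒≤ locate-injective
  where
  locate : Fin N → Fin N'
  locate i = proj₁ (e'-onto (e i) (e-in i))
  locate-spec : ∀ i → e' (locate i) ≈ e i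
  locate-spec i = proj₂ (e'-onto (e i) (e-in i))
  locate-injective : ∀ {i j} → locate i ≡ locate j → i ≡ j
  locate-injective {i} {j} eq = e-inj i j
    λ x → trans (sym (locate-spec i x)) (trans (cong (λ y → fun (e' y) x) eq) (locate-spec j x))

count-unique : ∀ {P N N'} → IsCount P N → IsCount P N' → N ≡ N'
count-unique c c' = ≤-antisym (count-≤ c c') (count-≤ c' c)

count-cong : ∀ {P Q N} → (∀ s → P s → Q s) → (∀ s → Q s → P s) → IsCount P N → IsCount Q N
count-cong P⇒Q Q⇒P (e , e-in , e-inj , e-onto) =
  e , (λ i → P⇒Q _ (e-in i)) , e-inj , (λ s q → e-onto s (Q⇒P s q))

count-empty : ∀ {P} → (∀ s → ¬ P s) → IsCount P 0
count-empty ¬P = (λ ()) , (λ ()) , (λ ()) , (λ s p → ⊥-elim (¬P s p))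

count-singleton : ∀ σ₀ → IsCount (σ₀ ≈_) 1
count-singleton σ₀ = (λ _ → σ₀) , (λ _ _ → refl) , (λ { zero zero _ → refl }) , (λ s p → zero , p)

count-⊎ : ∀ {P Q N₁ N₂} → IsCount P N₁ → IsCount Q N₂ → (∀ s s' → s ≈ s' → P s → Q s' → ⊥)
        → IsCount (λ s → P s ⊎ Q s) (N₁ + N₂)
count-⊎ {P} {Q} {N₁} {N₂} (e₁ , e₁-in , e₁-inj , e₁-onto) (e₂ , e₂-in , e₂-inj , e₂-onto) disjoint =
  count-via +↔⊎ e (e-in , e-inj , e-onto)
  where
  e : Fin N₁ ⊎ Fin N₂ → SInf
  e = [ e₁ , e₂ ]′
  e-in : ∀ x → P (e x) ⊎ Q (e x)
  e-in (inj₁ i) = inj₁ (e₁-in i)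
  e-in (inj₂ j) = inj₂ (e₂-in j)
  e-inj : ∀ x y → e x ≈ e y → x ≡ y
  e-inj (inj₁ i) (inj₁ i') eq = cong inj₁ (e₁-inj i i' eq)
  e-inj (inj₂ j) (inj₂ j') eq = cong inj₂ (e₂-inj j j' eq)
  e-inj (inj₁ i) (inj₂ j) eq = ⊥-elim (disjoint _ _ eq (e₁-in i) (e₂-in j))
  e-inj (inj₂ j) (inj₁ i) eq = ⊥-elim (disjoint _ _ (λ x → sym (eq x)) (e₁-in i) (e₂-in j))
  e-onto : ∀ s → P s ⊎ Q s → Σ (Fin N₁ ⊎ Fin N₂) λ x → e x ≈ s
  e-onto s (inj₁ p) with e₁-onto s p
  ... | i , ei≈s = inj₁ i , ei≈s
  e-onto s (inj₂ q) with e₂-onto s q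
  ... | j , ej≈s = inj₂ j , ej≈s

sumBelow : ℕ → (ℕ → ℕ) → ℕ
sumBelow n h = sum (applyUpTo h n)

count-family : ∀ n (P : ℕ → SInf → Set) (N : ℕ → ℕ) → (∀ j → j < n → IsCount (P j) (N j))
             → (∀ j j' s s' → s ≈ s' → P j s → P j' s' → j ≡ j')
             → IsCount (λ s → Σ ℕ λ j → j < n × P j s) (sumBelow n N)
count-family zero P N counts disjoint = count-empty λ { s (j , () , _) }
count-family (suc n) P N counts disjoint =
  count-cong into out (count-⊎ (counts 0 (s≤s z≤n)) rest-count first-vs-rest)
  where
  rest-count : IsCount (λ s → Σ ℕ λ j → j < n × P (suc j) s) (sumBelow n (N ∘ suc))
  rest-count = count-family n (P ∘ suc) (N ∘ suc) (λ j j<n → counts (suc j) (s≤s j<n))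
                 (λ j j' s s' s≈s' p p' → suc-injective (disjoint _ _ s s' s≈s' p p'))
  first-vs-rest : ∀ s s' → s ≈ s' → P 0 s → (Σ ℕ λ j → j < n × P (suc j) s') → ⊥
  first-vs-rest s s' s≈s' p (j , _ , p') = 0≢1+n (disjoint 0 (suc j) s s' s≈s' p p')
  into : ∀ s → P 0 s ⊎ (Σ ℕ λ j → j < n × P (suc j) s) → Σ ℕ λ j → j < suc n × P j s
  into s (inj₁ p) = 0 , s≤s z≤n , p
  into s (inj₂ (j , j<n , p)) = suc j , s≤s j<n , p
  out : ∀ s → (Σ ℕ λ j → j < suc n × P j s) → P 0 s ⊎ (Σ ℕ λ j → j < n × P (suc j) s)
  out s (zero , _ , p) = inj₁ p
  out s (suc j , s≤s j<n , p) = inj₂ (j , j<n , p)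

concat-prefix : ∀ a τ (τa : τ ∈S a) ρ i → i < a → fun (concat a τ τa ρ) i ≡ fun τ i
concat-prefix a τ τa ρ i i<a with i <? a
... | yes _   = refl
... | no i≮a = ⊥-elim (i≮a i<a)

concat-shifted : ∀ a τ (τa : τ ∈S a) ρ i → fun (concat a τ τa ρ) (a + i) ≡ a + fun ρ i
concat-shifted a τ τa ρ i with a + i <? a
... | yes a+i<a = ⊥-elim (m+n≮m a i a+i<a)
... | no _      = cong (λ x → a + fun ρ x) (m+n∸m≡n a i)

concat-cong : ∀ a τ τ' (τa : τ ∈S a) (τ'a : τ' ∈S a) ρ ρ' → τ ≈ τ' → ρ ≈ ρ'
            → concat a τ τa ρ ≈ concat a τ' τ'a ρ'
concat-cong a τ τ' τa τ'a ρ ρ' τ≈τ' ρ≈ρ' i with i <? a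
... | yes _ = τ≈τ' i
... | no _  = cong (a +_) (ρ≈ρ' (i ∸ a))

concat-injective : ∀ a τ τ' (τa : τ ∈S a) (τ'a : τ' ∈S a) ρ ρ'
                 → concat a τ τa ρ ≈ concat a τ' τ'a ρ' → τ ≈ τ' × ρ ≈ ρ'
concat-injective a τ τ' τa τ'a ρ ρ' eq = τ≈τ' , ρ≈ρ'
  where
  τ≈τ' : τ ≈ τ'
  τ≈τ' i with i <? a
  ... | yes i<a = trans (sym (concat-prefix a τ τa ρ i i<a)) (trans (eq i) (concat-prefix a τ' τ'a ρ' i i<a))
  ... | no i≮a  = trans (τa i (≮⇒≥ i≮a)) (sym (τ'a i (≮⇒≥ i≮a)))
  ρ≈ρ' : ρ ≈ ρ'
  ρ≈ρ' i = +-cancelˡ-≡ a _ _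
    (trans (sym (concat-shifted a τ τa ρ i)) (trans (eq (a + i)) (concat-shifted a τ' τ'a ρ' i)))

concat-idʳ : ∀ a τ (τa : τ ∈S a) ρ → ρ ≈ idP → concat a τ τa ρ ≈ τ
concat-idʳ a τ τa ρ ρ≈id i with i <? a
... | yes _  = refl
... | no i≮a = trans (cong (a +_) (ρ≈id (i ∸ a))) (trans (m+[n∸m]≡n (≮⇒≥ i≮a)) (sym (τa i (≮⇒≥ i≮a))))

ConcatOf : ℕ → (SInf → Set) → (SInf → Set) → SInf → Set
ConcatOf a A B σ = Σ SInf λ τ → Σ (τ ∈S a) λ τa → Σ SInf λ ρ → A τ × B ρ × σ ≈ concat a τ τa ρ

-- Concatenation is injective, so the counts of the two factors multiply.
count-concat : ∀ a {A B NA NB} → (∀ τ → A τ → τ ∈S a) → IsCount A NA → IsCount B NB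
             → IsCount (ConcatOf a A B) (NA * NB)
count-concat a {A} {B} {NA} {NB} A⊆Sa (eA , eA-in , eA-inj , eA-onto) (eB , eB-in , eB-inj , eB-onto) =
  count-via *↔× e (e-in , e-inj , e-onto)
  where
  e : Fin NA × Fin NB → SInf
  e (i , j) = concat a (eA i) (A⊆Sa _ (eA-in i)) (eB j)
  e-in : ∀ x → ConcatOf a A B (e x)
  e-in (i , j) = eA i , A⊆Sa _ (eA-in i) , eB j , eA-in i , eB-in j , (λ _ → refl)
  e-inj : ∀ x y → e x ≈ e y → x ≡ y
  e-inj (i , j) (i' , j') eq
    with concat-injective a (eA i) (eA i') (A⊆Sa _ (eA-in i)) (A⊆Sa _ (eA-in i')) (eB j) (eB j') eq
  ... | τ≈τ' , ρ≈ρ' = cong₂ _,_ (eA-inj i i' τ≈τ') (eB-inj j j' ρ≈ρ')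
  e-onto : ∀ s → ConcatOf a A B s → Σ (Fin NA × Fin NB) λ x → e x ≈ s
  e-onto s (τ , τa , ρ , Aτ , Bρ , s≈τ+ρ) with eA-onto τ Aτ | eB-onto ρ Bρ
  ... | i , eAi≈τ | j , eBj≈ρ = (i , j) , λ x → trans (concat-cong a (eA i) τ (A⊆Sa _ (eA-in i)) τa (eB j) ρ eAi≈τ eBj≈ρ x) (sym (s≈τ+ρ x))

-- Splitting off an initial block

below-closed : ∀ a (f g : ℕ → ℕ) → (∀ i → g (f i) ≡ i) → (∀ i → a ≤ i → f i ≡ i)
             → ∀ i → i < a → f i < a
below-closed a f g gf f-fixes i i<a with a ≤? f i
... | no a≰fi  = ≰⇒> a≰fi
... | yes a≤fi = ⊥-elim (<⇒≱ i<a (subst (a ≤_) fi≡i a≤fi))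
  where
  -- f fixes f i, and f is injective
  fi≡i : f i ≡ i
  fi≡i = begin
    f i           ≡⟨ sym (gf (f i)) ⟩
    g (f (f i))   ≡⟨ cong g (f-fixes (f i) a≤fi) ⟩
    g (f i)       ≡⟨ gf i ⟩
    i             ∎

above-closed : ∀ a (f g : ℕ → ℕ) → (∀ i → g (f i) ≡ i) → (∀ i → i < a → g i < a)
             → ∀ i → a ≤ i → a ≤ f i
above-closed a f g gf g-below i a≤i with a ≤? f i
... | yes a≤fi = a≤fi
... | no a≰fi  = ⊥-elim (<⇒≱ (subst (_< a) (gf i) (g-below (f i) (≰⇒> a≰fi))) a≤i)

fun-below : ∀ {a} τ → τ ∈S a → ∀ i → i < a → fun τ i < a
fun-below {a} τ τa = below-closed a (fun τ) (inv τ) (inv-fun τ) τa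

inv-below : ∀ {a} τ → τ ∈S a → ∀ i → i < a → inv τ i < a
inv-below {a} τ τa = below-closed a (inv τ) (fun τ) (fun-inv τ)
  (λ i a≤i → trans (cong (inv τ) (sym (τa i a≤i))) (inv-fun τ i))

-- If σ ∈S b agrees on [0,a) with some τ ∈S a, a ≤ b, then σ = τ + ρ with
-- ρ ∈S (b ∸ a): ρ is σ restricted to [a,∞) and shifted down by a.
split-off : ∀ a b τ σ (τa : τ ∈S a) → σ ∈S b → a ≤ b → (∀ i → i < a → fun σ i ≡ fun τ i)
          → Σ SInf λ ρ → ρ ∈S (b ∸ a) × σ ≈ concat a τ τa ρ
split-off a b τ σ τa σb a≤b agree = ρ , ρ∈S , σ≈τ+ρ
  where
  σ-below : ∀ i → i < a → fun σ i < a
  σ-below i i<a = subst (_< a) (sym (agree i i<a)) (fun-below τ τa i i<a)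
  σ⁻¹-below : ∀ i → i < a → inv σ i < a
  σ⁻¹-below i i<a = subst (_< a) τ⁻¹≡σ⁻¹ (inv-below τ τa i i<a)
    where
    τ⁻¹≡σ⁻¹ : inv τ i ≡ inv σ i
    τ⁻¹≡σ⁻¹ = begin
      inv τ i                   ≡⟨ sym (inv-fun σ (inv τ i)) ⟩
      inv σ (fun σ (inv τ i))   ≡⟨ cong (inv σ) (agree (inv τ i) (inv-below τ τa i i<a)) ⟩
      inv σ (fun τ (inv τ i))   ≡⟨ cong (inv σ) (fun-inv τ i) ⟩
      inv σ i                   ∎
  σ-above : ∀ i → a ≤ i → a ≤ fun σ i
  σ-above = above-closed a (fun σ) (inv σ) (inv-fun σ) σ⁻¹-below
  σ⁻¹-above : ∀ i → a ≤ i → a ≤ inv σ i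
  σ⁻¹-above = above-closed a (inv σ) (fun σ) (fun-inv σ) σ-below

  shift : (ℕ → ℕ) → ℕ → ℕ
  shift f i = f (a + i) ∸ a
  shift-inverse : (f g : ℕ → ℕ) → (∀ i → a ≤ i → a ≤ f i) → (∀ i → g (f i) ≡ i)
                → ∀ i → shift g (shift f i) ≡ i
  shift-inverse f g f-above gf i = begin
    g (a + (f (a + i) ∸ a)) ∸ a   ≡⟨ cong (λ x → g x ∸ a) (m+[n∸m]≡n (f-above (a + i) (m≤m+n a i))) ⟩
    g (f (a + i)) ∸ a             ≡⟨ cong (_∸ a) (gf (a + i)) ⟩
    a + i ∸ a                     ≡⟨ m+n∸m≡n a i ⟩
    i                             ∎
  shift-fixed : ∀ i → fun σ (a + i) ≡ a + i → shift (fun σ) i ≡ i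
  shift-fixed i σ-fixes = trans (cong (_∸ a) σ-fixes) (m+n∸m≡n a i)

  ρ : SInf
  ρ = record
    { fun = shift (fun σ) ; inv = shift (inv σ)
    ; inv-fun = shift-inverse (fun σ) (inv σ) σ-above (inv-fun σ)
    ; fun-inv = shift-inverse (inv σ) (fun σ) σ⁻¹-above (fun-inv σ)
    ; bound = bound σ
    ; fixes = λ i p → shift-fixed i (fixes σ (a + i) (≤-trans p (m≤n+m i a)))
    }
  ρ∈S : ρ ∈S (b ∸ a)
  ρ∈S i b∸a≤i = shift-fixed i (σb (a + i) (subst (_≤ a + i) (m+[n∸m]≡n a≤b) (+-monoʳ-≤ a b∸a≤i)))
  σ≈τ+ρ : σ ≈ concat a τ τa ρ
  σ≈τ+ρ i with i <? a
  ... | yes i<a = agree i i<a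
  ... | no i≮a  = sym (begin
    a + (fun σ (a + (i ∸ a)) ∸ a)   ≡⟨ cong (λ x → a + (fun σ x ∸ a)) (m+[n∸m]≡n (≮⇒≥ i≮a)) ⟩
    a + (fun σ i ∸ a)               ≡⟨ m+[n∸m]≡n (σ-above i (≮⇒≥ i≮a)) ⟩
    fun σ i                         ∎)

connected-no-initial-block : ∀ {a a'} τ τ' (τa : τ ∈S a) → 1 ≤ a → a < a' → Connected a' τ'
                           → ¬ (∀ i → i < a → fun τ' i ≡ fun τ i)
connected-no-initial-block {a} {a'} τ τ' τa 1≤a a<a' (τ'a' , _ , indecomposable) agree
  with split-off a a' τ τ' τa τ'a' (<⇒≤ a<a') agree
... | ρ , ρ∈S , τ'≈τ+ρ =
  indecomposable (a , a' ∸ a , τ , ρ , τa , ρ∈S , 1≤a , m<n⇒0<n∸m a<a' , m+[n∸m]≡n (<⇒≤ a<a') , τ'≈τ+ρ)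

concat-agree-below : ∀ {a a'} τ τ' (τa : τ ∈S a) (τ'a' : τ' ∈S a') ρ ρ' → a < a'
                   → concat a τ τa ρ ≈ concat a' τ' τ'a' ρ' → ∀ i → i < a → fun τ' i ≡ fun τ i
concat-agree-below {a} {a'} τ τ' τa τ'a' ρ ρ' a<a' eq i i<a = begin
  fun τ' i                          ≡⟨ sym (concat-prefix a' τ' τ'a' ρ' i (<-trans i<a a<a')) ⟩
  fun (concat a' τ' τ'a' ρ') i      ≡⟨ sym (eq i) ⟩
  fun (concat a τ τa ρ) i           ≡⟨ concat-prefix a τ τa ρ i i<a ⟩
  fun τ i                           ∎

first-block-unique : ∀ {a a'} τ τ' (τa : τ ∈S a) (τ'a' : τ' ∈S a') ρ ρ' → Connected a τ → Connected a' τ'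
                   → concat a τ τa ρ ≈ concat a' τ' τ'a' ρ' → a ≡ a' × τ ≈ τ'
first-block-unique {a} {a'} τ τ' τa τ'a' ρ ρ' τ-conn τ'-conn eq with <-cmp a a'
... | tri≈ _ refl _ = refl , proj₁ (concat-injective a τ τ' τa τ'a' ρ ρ' eq)
... | tri< a<a' _ _ = ⊥-elim (connected-no-initial-block τ τ' τa (proj₁ (proj₂ τ-conn)) a<a' τ'-conn
                        (concat-agree-below τ τ' τa τ'a' ρ ρ' a<a' eq))
... | tri> _ _ a'<a = ⊥-elim (connected-no-initial-block τ' τ τ'a' (proj₁ (proj₂ τ'-conn)) a'<a τ-conn
                        (concat-agree-below τ' τ τ'a' τa ρ' ρ a'<a (λ i → sym (eq i))))

splitType-∈S : ∀ {m q σ} → IsSplitType m q σ → σ ∈S m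
splitType-∈S (nil σ≈id) i _ = σ≈id i
splitType-∈S {σ = σ} (cons {a} {m} τ τa ρ _ _ ρ-split σ≈τ+ρ) i a+m≤i = begin
  fun σ i                      ≡⟨ σ≈τ+ρ i ⟩
  fun (concat a τ τa ρ) i      ≡⟨ cong (fun (concat a τ τa ρ)) (sym (m+[n∸m]≡n a≤i)) ⟩
  fun (concat a τ τa ρ) (a + (i ∸ a)) ≡⟨ concat-shifted a τ τa ρ (i ∸ a) ⟩
  a + fun ρ (i ∸ a)            ≡⟨ cong (a +_) (splitType-∈S ρ-split (i ∸ a) m≤i∸a) ⟩
  a + (i ∸ a)                  ≡⟨ m+[n∸m]≡n a≤i ⟩
  i                            ∎
  where
  a≤i : a ≤ i
  a≤i = ≤-trans (m≤m+n a m) a+m≤i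
  m≤i∸a : m ≤ i ∸ a
  m≤i∸a = subst (_≤ i ∸ a) (m+n∸m≡n a m) (∸-monoˡ-≤ a a+m≤i)

connected-cong : ∀ {a τ τ'} → τ ≈ τ' → Connected a τ → Connected a τ'
connected-cong τ≈τ' (τa , 1≤a , indecomposable) =
  (λ i a≤i → trans (sym (τ≈τ' i)) (τa i a≤i)) , 1≤a ,
  λ { (b , c , π , ρ , πb , ρc , 1≤b , 1≤c , b+c≡a , τ'≈π+ρ) →
      indecomposable (b , c , π , ρ , πb , ρc , 1≤b , 1≤c , b+c≡a , λ i → trans (τ≈τ' i) (τ'≈π+ρ i)) }

nontrivial-cong : ∀ {a τ τ'} → τ ≈ τ' → ¬ Trivial a τ → ¬ Trivial a τ'
nontrivial-cong τ≈τ' nontrivial (a≡1 , τ'≈id) = nontrivial (a≡1 , λ i → trans (τ≈τ' i) (τ'≈id i))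

single-part⇒connected : ∀ {a τ} → IsSplitType a 1 τ → Connected a τ × ¬ Trivial a τ
single-part⇒connected {τ = τ} (cons {a} τ' τ'a ρ τ'-conn τ'-nontriv (nil ρ≈id) τ≈τ'+ρ) =
  subst (λ x → Connected x τ × ¬ Trivial x τ) (sym (+-identityʳ a))
    (connected-cong {a} {τ'} {τ} τ'≈τ τ'-conn , nontrivial-cong {a} {τ'} {τ} τ'≈τ τ'-nontriv)
  where
  τ'≈τ : τ' ≈ τ
  τ'≈τ i = sym (trans (τ≈τ'+ρ i) (concat-idʳ a τ' τ'a ρ ρ≈id i))

connected⇒single-part : ∀ {a τ} → Connected a τ → ¬ Trivial a τ → IsSplitType a 1 τ
connected⇒single-part {a} {τ} τ-conn τ-nontriv = subst (λ x → IsSplitType x 1 τ) (+-identityʳ a)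
  (cons τ τa idP τ-conn τ-nontriv (nil (λ _ → refl)) (λ i → sym (concat-idʳ a τ τa idP (λ _ → refl) i)))
  where
  τa : τ ∈S a
  τa = proj₁ τ-conn

-- The identity of S_a is connected only for a = 1, since id_a = id_1 + id_{a-1}.
connected-identity : ∀ {a τ} → Connected a τ → τ ≈ idP → a ≡ 1
connected-identity {suc zero} _ _ = refl
connected-identity {suc (suc b)} {τ} (_ , _ , indecomposable) τ≈id =
  ⊥-elim (indecomposable (1 , suc b , idP , idP , id∈S 1 , id∈S (suc b) , s≤s z≤n , s≤s z≤n , refl ,
          λ i → trans (τ≈id i) (sym (concat-idʳ 1 idP (id∈S 1) idP (λ _ → refl) i))))
  where
  id∈S : ∀ n → idP ∈S n
  id∈S _ _ _ = refl

module _ {D : SInf → SInf → ℕ} (metric : IsMetric D) where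
  open IsMetric metric

  D-congʳ : ∀ u {σ σ'} → σ ≈ σ' → D u σ ≡ D u σ'
  D-congʳ u {σ} {σ'} σ≈σ' = ≤-antisym (≤-via σ σ' σ≈σ') (≤-via σ' σ (λ i → sym (σ≈σ' i)))
    where
    -- D(u,σ) ≤ D(u,σ') + D(σ',σ) = D(u,σ')
    ≤-via : ∀ σ σ' → σ ≈ σ' → D u σ ≤ D u σ'
    ≤-via σ σ' σ≈σ' = ≤-trans (triangle u σ' σ)
      (≤-reflexive (trans (cong (D u σ' +_) (≈⇒zero σ' σ (λ i → sym (σ≈σ' i)))) (+-identityʳ _)))

  -- A nontrivial connected permutation is not the identity, so it has positive distance.
  D-positive : ∀ {a τ} → Connected a τ → ¬ Trivial a τ → D idP τ ≢ 0
  D-positive {a} {τ} τ-conn τ-nontriv D≡0 =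
    τ-nontriv (connected-identity {a} {τ} τ-conn τ≈id , τ≈id)
    where
    τ≈id : τ ≈ idP
    τ≈id i = sym (zero⇒≈ idP _ D≡0 i)

-- The recursion satisfied by the composition sum

sum-map-++ : ∀ {A : Set} (h : A → ℕ) xs ys → sum (map h (xs ++ ys)) ≡ sum (map h xs) + sum (map h ys)
sum-map-++ h xs ys = trans (cong sum (map-++ h xs ys)) (sum-++ (map h xs) (map h ys))

sum-map-concatMap : ∀ {A B : Set} (h : B → ℕ) (g : A → List B) xs
                  → sum (map h (concatMap g xs)) ≡ sum (map (λ x → sum (map h (g x))) xs)
sum-map-concatMap h g []       = refl
sum-map-concatMap h g (x ∷ xs) =
  trans (sum-map-++ h (g x) (concatMap g xs)) (cong (sum (map h (g x)) +_) (sum-map-concatMap h g xs))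

sum-map-cong : ∀ {A : Set} {h h' : A → ℕ} → (∀ x → h x ≡ h' x) → ∀ xs → sum (map h xs) ≡ sum (map h' xs)
sum-map-cong h≗h' xs = cong sum (map-cong h≗h' xs)

sum-map-scale : ∀ {A : Set} c (h : A → ℕ) xs → sum (map (λ x → c * h x) xs) ≡ c * sum (map h xs)
sum-map-scale c h []       = sym (*-zeroʳ c)
sum-map-scale c h (x ∷ xs) = trans (cong (c * h x +_) (sum-map-scale c h xs)) (sym (*-distribˡ-+ c (h x) _))

sumBelow-cong : ∀ n {h h' : ℕ → ℕ} → (∀ j → h j ≡ h' j) → sumBelow n h ≡ sumBelow n h'
sumBelow-cong zero    h≗h' = refl
sumBelow-cong (suc n) h≗h' = cong₂ _+_ (h≗h' 0) (sumBelow-cong n (h≗h' ∘ suc))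

sumBelow-zero : ∀ n → sumBelow n (λ _ → 0) ≡ 0
sumBelow-zero zero    = refl
sumBelow-zero (suc n) = sumBelow-zero n

sumBelow-+ : ∀ n h h' → sumBelow n h + sumBelow n h' ≡ sumBelow n (λ j → h j + h' j)
sumBelow-+ zero    h h' = refl
sumBelow-+ (suc n) h h' =
  trans (interchange (h 0) _ (h' 0) _) (cong (h 0 + h' 0 +_) (sumBelow-+ n (h ∘ suc) (h' ∘ suc)))

sum-map-sumBelow : ∀ {A : Set} n (F : A → ℕ → ℕ) xs
                 → sum (map (λ x → sumBelow n (F x)) xs) ≡ sumBelow n (λ j → sum (map (λ x → F x j) xs))
sum-map-sumBelow n F []       = sym (sumBelow-zero n)
sum-map-sumBelow n F (x ∷ xs) = trans (cong (sumBelow n (F x) +_) (sum-map-sumBelow n F xs)) (sumBelow-+ n _ _)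

sum-by-first-entry : ∀ n (G : ℕ → List (List ℕ)) (h : List ℕ → ℕ)
                   → sum (map h (concatMap (λ j → map (suc j ∷_) (G j)) (upTo n)))
                     ≡ sumBelow n (λ j → sum (map (λ xs → h (suc j ∷ xs)) (G j)))
sum-by-first-entry n G h = begin
  sum (map h (concatMap (λ j → map (suc j ∷_) (G j)) (upTo n)))
    ≡⟨ sum-map-concatMap h (λ j → map (suc j ∷_) (G j)) (upTo n) ⟩
  sum (map (λ j → sum (map h (map (suc j ∷_) (G j)))) (upTo n))
    ≡⟨ cong sum (map-applyUpTo (λ j → j) _ n) ⟩
  sumBelow n (λ j → sum (map h (map (suc j ∷_) (G j))))
    ≡⟨ sumBelow-cong n (λ j → cong sum (sym (map-∘ (G j)))) ⟩
  sumBelow n (λ j → sum (map (λ xs → h (suc j ∷ xs)) (G j)))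
    ∎

compSumOver : ℕ → ℕ → (ℕ → ℕ → ℕ) → List ℕ → ℕ
compSumOver q m f ks = sum (map (λ ms → product (zipWith f ks ms)) (compositions q m))

compSumOver-suc : ∀ q m f j ks → compSumOver (suc q) m f (suc j ∷ ks)
                ≡ sumBelow m (λ l → f (suc j) (suc l) * compSumOver q (m ∸ suc l) f ks)
compSumOver-suc q m f j ks = trans
  (sum-by-first-entry m (λ l → compositions q (m ∸ suc l)) (λ ms → product (zipWith f (suc j ∷ ks) ms)))
  (sumBelow-cong m (λ l → sum-map-scale (f (suc j) (suc l)) _ (compositions q (m ∸ suc l))))

-- Splitting off the first parts (k₁, m₁) = (j+1, l+1) of both compositions.
compSum-suc : ∀ q k m f → compSum (suc q) k m f
            ≡ sumBelow k (λ j → sumBelow m (λ l → f (suc j) (suc l) * compSum q (k ∸ suc j) (m ∸ suc l) f))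
compSum-suc q k m f = begin
  compSum (suc q) k m f
    ≡⟨ sum-by-first-entry k (λ j → compositions q (k ∸ suc j)) (compSumOver (suc q) m f) ⟩
  sumBelow k (λ j → sum (map (λ ks → compSumOver (suc q) m f (suc j ∷ ks)) (compositions q (k ∸ suc j))))
    ≡⟨ sumBelow-cong k (λ j → sum-map-cong (compSumOver-suc q m f j) (compositions q (k ∸ suc j))) ⟩
  sumBelow k (λ j → sum (map (λ ks → sumBelow m (λ l → f (suc j) (suc l) * compSumOver q (m ∸ suc l) f ks))
                             (compositions q (k ∸ suc j))))
    ≡⟨ sumBelow-cong k (λ j → sum-map-sumBelow m _ (compositions q (k ∸ suc j))) ⟩
  sumBelow k (λ j → sumBelow m (λ l → sum (map (λ ks → f (suc j) (suc l) * compSumOver q (m ∸ suc l) f ks)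
                                                (compositions q (k ∸ suc j)))))
    ≡⟨ sumBelow-cong k (λ j → sumBelow-cong m (λ l → sum-map-scale (f (suc j) (suc l)) _ (compositions q (k ∸ suc j)))) ⟩
  sumBelow k (λ j → sumBelow m (λ l → f (suc j) (suc l) * compSum q (k ∸ suc j) (m ∸ suc l) f))
    ∎

-- Counting split types by splitting off the first part

module SplitTypeCount (D : SInf → SInf → ℕ) (metric : IsMetric D) (additive : Additive D) where
  open IsMetric metric using (≈⇒zero)

  SplitType : ℕ → ℕ → ℕ → SInf → Set
  SplitType k m q σ = IsSplitType m q σ × D idP σ ≡ k

  D-concat : ∀ {a b σ τ ρ} (τa : τ ∈S a) → ρ ∈S b → σ ≈ concat a τ τa ρ → D idP σ ≡ D idP τ + D idP ρ
  D-concat {a} {b} {σ} {τ} {ρ} τa ρb σ≈τ+ρ = trans (D-congʳ metric idP σ≈τ+ρ) (additive a b τ ρ τa ρb)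

  FirstPart : ℕ → ℕ → ℕ → ℕ → ℕ → SInf → Set
  FirstPart k m q j l = ConcatOf (suc l) (SplitType (suc j) (suc l) 1) (SplitType (k ∸ suc j) (m ∸ suc l) q)

  Decomposed : ℕ → ℕ → ℕ → SInf → Set
  Decomposed k m q σ = Σ ℕ λ j → j < k × Σ ℕ λ l → l < m × FirstPart k m q j l σ

  recompose : ∀ {k m q σ} → Decomposed k m q σ → SplitType k m (suc q) σ
  recompose {k} {m} {q} {σ} (j , j<k , l , l<m , τ , τa , ρ , (τ-split , Dτ) , (ρ-split , Dρ) , σ≈τ+ρ) =
    subst (λ x → IsSplitType x (suc q) σ) (m+[n∸m]≡n l<m)
      (cons τ τa ρ (proj₁ τ-block) (proj₂ τ-block) ρ-split σ≈τ+ρ) ,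
    (begin
      D idP σ               ≡⟨ D-concat τa (splitType-∈S ρ-split) σ≈τ+ρ ⟩
      D idP τ + D idP ρ     ≡⟨ cong₂ _+_ Dτ Dρ ⟩
      suc j + (k ∸ suc j)   ≡⟨ m+[n∸m]≡n j<k ⟩
      k                     ∎)
    where
    τ-block : Connected (suc l) τ × ¬ Trivial (suc l) τ
    τ-block = single-part⇒connected τ-split

  -- The first part is nonempty and, being nontrivial and connected, has D ≥ 1.
  decompose : ∀ {k m q σ} → SplitType k m (suc q) σ → Decomposed k m q σ
  decompose (cons {zero} _ _ _ (_ , () , _) _ _ _ , _)
  decompose {k} {q = q} (cons {suc l} {m'} τ τa ρ τ-conn τ-nontriv ρ-split σ≈τ+ρ , Dσ) with D idP τ in Dτ
  ... | zero  = ⊥-elim (D-positive metric τ-conn τ-nontriv Dτ)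
  ... | suc j = j , j<k , l , s≤s (m≤m+n l m') , τ , τa , ρ ,
                (connected⇒single-part τ-conn τ-nontriv , Dτ) , (ρ-split′ , Dρ) , σ≈τ+ρ
    where
    Dτ+Dρ : suc j + D idP ρ ≡ k
    Dτ+Dρ = begin
      suc j + D idP ρ       ≡⟨ cong (_+ D idP ρ) (sym Dτ) ⟩
      D idP τ + D idP ρ     ≡⟨ sym (D-concat τa (splitType-∈S ρ-split) σ≈τ+ρ) ⟩
      D idP _               ≡⟨ Dσ ⟩
      k                     ∎
    j<k : j < k
    j<k = subst (suc j ≤_) Dτ+Dρ (m≤m+n (suc j) _)
    Dρ : D idP ρ ≡ k ∸ suc j
    Dρ = trans (sym (m+n∸m≡n (suc j) (D idP ρ))) (cong (_∸ suc j) Dτ+Dρ)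
    ρ-split′ : IsSplitType (suc l + m' ∸ suc l) q ρ
    ρ-split′ = subst (λ x → IsSplitType x q ρ) (sym (m+n∸m≡n (suc l) m')) ρ-split

  firstPart-unique : ∀ k m q {j l j' l'} s s' → s ≈ s' → FirstPart k m q j l s → FirstPart k m q j' l' s'
                   → l ≡ l' × j ≡ j'
  firstPart-unique _ _ _ _ _ s≈s' (τ , τa , ρ , (τ-split , Dτ) , _ , s≈τ+ρ) (τ' , τ'a , ρ' , (τ'-split , Dτ') , _ , s'≈τ'+ρ')
    with first-block-unique τ τ' τa τ'a ρ ρ'
           (proj₁ (single-part⇒connected τ-split)) (proj₁ (single-part⇒connected τ'-split))
           (λ i → trans (sym (s≈τ+ρ i)) (trans (s≈s' i) (s'≈τ'+ρ' i)))
  ... | l+1≡l'+1 , τ≈τ' =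
    suc-injective l+1≡l'+1 , suc-injective (trans (sym Dτ) (trans (D-congʳ metric idP τ≈τ') Dτ'))

  -- Counting Decomposed: a disjoint union over (j, l) of concatenation products.
  count-decomposed : ∀ q (β c : ℕ → ℕ → ℕ)
    → (∀ j l → IsCount (SplitType (suc j) (suc l) 1) (β (suc j) (suc l)))
    → (∀ k m → IsCount (SplitType k m q) (c k m))
    → ∀ k m → IsCount (Decomposed k m q)
                (sumBelow k (λ j → sumBelow m (λ l → β (suc j) (suc l) * c (k ∸ suc j) (m ∸ suc l))))
  count-decomposed q β c count-parts count-rest k m =
    count-family k (λ j σ → Σ ℕ λ l → l < m × FirstPart k m q j l σ)
      (λ j → sumBelow m (λ l → β (suc j) (suc l) * c (k ∸ suc j) (m ∸ suc l)))
      (λ j _ → count-family m (FirstPart k m q j) (λ l → β (suc j) (suc l) * c (k ∸ suc j) (m ∸ suc l))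
                 (λ l _ → count-concat (suc l) (λ τ → splitType-∈S ∘ proj₁)
                            (count-parts j l) (count-rest (k ∸ suc j) (m ∸ suc l)))
                 (λ l l' s s' s≈s' p p' → proj₁ (firstPart-unique k m q s s' s≈s' p p')))
      (λ { j j' s s' s≈s' (l , _ , p) (l' , _ , p') → proj₂ (firstPart-unique k m q s s' s≈s' p p') })

  count-no-parts : ∀ (β : ℕ → ℕ → ℕ) k m → IsCount (SplitType k m 0) (compSum 0 k m β)
  count-no-parts β zero zero =
    count-cong (λ s id≈s → nil (λ i → sym (id≈s i)) , ≈⇒zero idP s id≈s)
               (λ { s (nil s≈id , _) i → sym (s≈id i) })
               (count-singleton idP)
  count-no-parts β zero (suc m) = count-empty λ { s (() , _) }
  count-no-parts β (suc k) (suc m) = count-empty λ { s (() , _) }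
  count-no-parts β (suc k) zero =
    count-empty λ { s (nil s≈id , Ds) → 0≢1+n (trans (sym (≈⇒zero idP s (λ i → sym (s≈id i)))) Ds) }

  count-splitTypes : ∀ (β : ℕ → ℕ → ℕ) → (∀ j l → IsCount (SplitType (suc j) (suc l) 1) (β (suc j) (suc l)))
                   → ∀ q k m → IsCount (SplitType k m q) (compSum q k m β)
  count-splitTypes β count-parts zero k m = count-no-parts β k m
  count-splitTypes β count-parts (suc q) k m =
    subst (IsCount (SplitType k m (suc q))) (sym (compSum-suc q k m β))
      (count-cong (λ _ → recompose) (λ _ → decompose)
        (count-decomposed q β (λ k' m' → compSum q k' m' β) count-parts
          (count-splitTypes β count-parts q) k m))

proposition3p4 : (D : SInf → SInf → ℕ) → IsMetric D → RightInvariant D → Additive D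
    → (β : ℕ → ℕ → ℕ → ℕ)
    → (∀ k m q → 1 ≤ k → 1 ≤ m → 1 ≤ q → IsBeta D k m q (β k m q))
    → ∀ k m q → 1 ≤ k → 1 ≤ m → 1 ≤ q
    → β k m q ≡ compSum q k m (λ ki mi → β ki mi 1)
proposition3p4 D metric _ additive β isBeta k m q 1≤k 1≤m 1≤q =
  count-unique (isBeta k m q 1≤k 1≤m 1≤q) (count-splitTypes (λ ki mi → β ki mi 1) count-parts q k m)
  where
  open SplitTypeCount D metric additive
  count-parts : ∀ j l → IsCount (SplitType (suc j) (suc l) 1) (β (suc j) (suc l) 1)
  count-parts j l = isBeta (suc j) (suc l) 1 (s≤s z≤n) (s≤s z≤n) (s≤s z≤n)
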